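{- Let $G$ be a strong bicentral $2$-tree on $n$ vertices with maximum degree $\Delta$ and tail set $\{2,3\}$, and let $x$ and $y$ be the numbers of tail vertices of degree $3$ and of degree $2$, respectively. Then $x=2(n-1-\Delta)$ and $y=2\Delta-n$. In particular, $x$ is even.
   Context: A $2$-tree is a graph obtained from the triangle $K_3$ by repeatedly adding a new vertex adjacent to both endpoints of an existing edge. For $r\in\{1,2,3\}$ and an integer $\Delta\ge 2$, a $2$-tree on $n$ vertices is $r$-central with maximum degree $\Delta$ if $\Delta$ is its maximum degree and exactly $r$ vertices have degree $\Delta$; these $r$ vertices form the core and the other $n-r$ vertices form the tail. It is strong if the core induces $K_r$. It has tail set $\{2,3\}$ if every tail vertex has degree $2$ or $3$. "Bicentral" means $2$-central. -}

module Defs where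

open import Data.Nat using (ℕ; zero; suc; _+_; _≤_; _≟_)
open import Data.Bool using (Bool; true; false; not; _∨_; if_then_else_)
open import Data.Fin using (Fin; zero; suc)
import Data.Fin as F
open import Data.Fin.Permutation using (Permutation′; _⟨$⟩ʳ_)
open import Data.List using (List; length; filter; sum; map)
open import Data.List.Base using ()
open import Data.Fin.Base using ()
open import Data.Product using (Σ; _×_; ∃-syntax)
open import Data.Sum using (_⊎_)
open import Relation.Binary.PropositionalEquality using (_≡_; _≢_)
open import Relation.Nullary using (¬_)
open import Relation.Nullary.Decidable using (¬?; ⌊_⌋)
import Data.List as L

Graph : ℕ → Set
Graph n = Fin n → Fin n → Bool

allV : (n : ℕ) → List (Fin n)
allV n = L.allFin n

K3 : Graph 3
K3 i j = not ⌊ i F.≟ j ⌋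

addVertex : ∀ {n} → Graph n → Fin n → Fin n → Graph (suc n)
addVertex G u v zero    zero    = false
addVertex G u v zero    (suc w) = ⌊ w F.≟ u ⌋ ∨ ⌊ w F.≟ v ⌋
addVertex G u v (suc w) zero    = ⌊ w F.≟ u ⌋ ∨ ⌊ w F.≟ v ⌋
addVertex G u v (suc a) (suc b) = G a b

relabel : ∀ {n} → Permutation′ n → Graph n → Graph n
relabel σ G a b = G (σ ⟨$⟩ʳ a) (σ ⟨$⟩ʳ b)

data TwoTree : (n : ℕ) → Graph n → Set where
  triangle : TwoTree 3 K3
  extend   : ∀ {n} {G : Graph n} (u v : Fin n) →
             TwoTree n G → G u v ≡ true → TwoTree (suc n) (addVertex G u v)
  rename   : ∀ {n} {G : Graph n} (σ : Permutation′ n) →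
             TwoTree n G → TwoTree n (relabel σ G)

deg : ∀ {n} → Graph n → Fin n → ℕ
deg {n} G a = length (filter (λ b → G a b Data.Bool.≟ true) (allV n))

-- G is a strong bicentral 2-tree with maximum degree Δ:
-- Δ ≥ 2 is the maximum degree, exactly two vertices a ≠ b have degree Δ,
-- and they are adjacent (the core induces K₂).
StrongBicentral : ∀ {n} → Graph n → ℕ → Set
StrongBicentral {n} G Δ =
  TwoTree n G × 2 ≤ Δ × (∀ v → deg G v ≤ Δ) ×
  (∃[ a ] ∃[ b ] (a ≢ b × deg G a ≡ Δ × deg G b ≡ Δ × G a b ≡ true ×
     (∀ v → deg G v ≡ Δ → v ≡ a ⊎ v ≡ b)))

-- Tail vertices: those whose degree is not Δ.
-- Tail set {2,3}: every tail vertex has degree 2 or 3.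
TailSet23 : ∀ {n} → Graph n → ℕ → Set
TailSet23 G Δ = ∀ v → ¬ (deg G v ≡ Δ) → deg G v ≡ 2 ⊎ deg G v ≡ 3

tailCount : ∀ {n} → Graph n → ℕ → ℕ → ℕ
tailCount {n} G Δ d =
  length (filter (λ v → deg G v ≟ d) (filter (λ v → ¬? (deg G v ≟ Δ)) (allV n)))

-- A 2-tree on n vertices has degree sum 4n − 6: the triangle has degree sum 6, and each
-- added vertex brings degree 2 and raises the degrees of its two neighbours by one.
-- Summing 1 and the degree over the two core vertices and the x + y tail vertices gives
-- n = 2 + y + x and 2Δ + 2y + 3x = 4n − 6, a linear system whose solution is
-- x = 2(n − 1 − Δ), y = 2Δ − n.

module Submission where

open import Defs
open import Data.Nat using (ℕ; zero; suc; _≟_)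
import Data.Nat as ℕ
open import Data.Nat.Properties using (+-*-semiring)
open import Data.Nat.Divisibility using (_∣_; m∣m*n)
open import Data.Bool using (Bool; true; false; _∧_; _∨_)
import Data.Bool as Bool
open import Data.Empty using (⊥-elim)
open import Data.Fin using (Fin; zero; suc)
import Data.Fin as Fin
open import Data.Fin.Permutation using (Permutation′; _⟨$⟩ʳ_)
open import Data.List using (List; []; _∷_; length; filter; tabulate)
open import Data.Product using (_×_; _,_; proj₁; proj₂)
open import Data.Sum using (_⊎_; inj₁; inj₂)
open import Function using (_∘_; id; _⇔_; mk⇔)
open import Relation.Binary.PropositionalEquality
  using (_≡_; _≢_; refl; sym; trans; cong; cong₂; subst; module ≡-Reasoning)
open import Relation.Nullary using (yes; no; does; ¬?; _⊎-dec_)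
open import Relation.Nullary.Decidable using (⌊_⌋; does-⇔; isYes≗does; dec-true; dec-false)
open import Relation.Unary using (Pred; Decidable)
open import Relation.Unary.Properties using (_∩?_)
open import Algebra.Properties.Semiring.Sum +-*-semiring
  using (sum; sum-syntax; sum-cong-≗; sum-replicate-zero; ∑-distrib-+; sum-permute; *-distribʳ-sum)

open ≡-Reasoning

-- ℕ's _+_ and _*_ are opened only inside this block: at top level they would clash
-- with the ℤ operators in the statement of lemma4p1.
module _ where
  open import Data.Nat using (_+_; _*_)
  open import Data.Nat.Properties using (*-suc; +-cancelʳ-≡)
  open import Data.Nat.Tactic.RingSolver using (solve)

  indicator : Bool → ℕ
  indicator true  = 1
  indicator false = 0

  ∑-one : ∀ n → ∑[ i < n ] 1 ≡ n
  ∑-one zero    = refl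
  ∑-one (suc n) = cong suc (∑-one n)

  ∑-distrib-+₃ : ∀ {n} (f g h : Fin n → ℕ) →
    ∑[ i < n ] (f i + g i + h i) ≡ sum f + sum g + sum h
  ∑-distrib-+₃ f g h = trans (∑-distrib-+ _ h) (cong (_+ sum h) (∑-distrib-+ f g))

  ∑-indicator-≟ : ∀ {n} (u : Fin n) → ∑[ w < n ] indicator (does (w Fin.≟ u)) ≡ 1
  ∑-indicator-≟ {suc n} zero    = cong suc (sum-replicate-zero n)
  ∑-indicator-≟ {suc n} (suc u) = ∑-indicator-≟ u

  ∑-indicator-pair : ∀ {n} {u v : Fin n} → u ≢ v →
    ∑[ w < n ] indicator (⌊ w Fin.≟ u ⌋ ∨ ⌊ w Fin.≟ v ⌋) ≡ 2
  ∑-indicator-pair {n} {u} {v} u≢v = begin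
    ∑[ w < n ] indicator (⌊ w Fin.≟ u ⌋ ∨ ⌊ w Fin.≟ v ⌋)
      ≡⟨ sum-cong-≗ indicator-∨ ⟩
    ∑[ w < n ] (indicator (does (w Fin.≟ u)) + indicator (does (w Fin.≟ v)))
      ≡⟨ ∑-distrib-+ (λ w → indicator (does (w Fin.≟ u))) (λ w → indicator (does (w Fin.≟ v))) ⟩
    ∑[ w < n ] indicator (does (w Fin.≟ u)) + ∑[ w < n ] indicator (does (w Fin.≟ v))
      ≡⟨ cong₂ _+_ (∑-indicator-≟ u) (∑-indicator-≟ v) ⟩
    2 ∎
    where
    indicator-∨ : ∀ w → indicator (⌊ w Fin.≟ u ⌋ ∨ ⌊ w Fin.≟ v ⌋) ≡
                        indicator (does (w Fin.≟ u)) + indicator (does (w Fin.≟ v))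
    indicator-∨ w with w Fin.≟ u | w Fin.≟ v
    ... | yes w≡u | yes w≡v = ⊥-elim (u≢v (trans (sym w≡u) w≡v))
    ... | yes _   | no _    = refl
    ... | no _    | yes _   = refl
    ... | no _    | no _    = refl

  module _ {a p q} {A : Set a} {P : Pred A p} {Q : Pred A q} where

    filter-filter : (P? : Decidable P) (Q? : Decidable Q) (xs : List A) →
                    filter P? (filter Q? xs) ≡ filter (Q? ∩? P?) xs
    filter-filter P? Q? []       = refl
    filter-filter P? Q? (x ∷ xs) with does (Q? x)
    ... | false = filter-filter P? Q? xs
    ... | true with does (P? x)
    ...   | true  = cong (x ∷_) (filter-filter P? Q? xs)
    ...   | false = filter-filter P? Q? xs

  length-filter-tabulate : ∀ {a p} {A : Set a} {P : Pred A p} (P? : Decidable P) {n} (f : Fin n → A) →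
    length (filter P? (tabulate f)) ≡ ∑[ i < n ] indicator (does (P? (f i)))
  length-filter-tabulate P? {zero}  f = refl
  length-filter-tabulate P? {suc n} f with does (P? (f zero))
  ... | true  = cong suc (length-filter-tabulate P? (f ∘ suc))
  ... | false = length-filter-tabulate P? (f ∘ suc)

  does-≟-true : ∀ b → does (b Bool.≟ true) ≡ b
  does-≟-true true  = refl
  does-≟-true false = refl

  deg≡∑ : ∀ {n} (G : Graph n) a → deg G a ≡ ∑[ b < n ] indicator (G a b)
  deg≡∑ G a = trans (length-filter-tabulate (λ b → G a b Bool.≟ true) id)
                    (sum-cong-≗ (cong indicator ∘ does-≟-true ∘ G a))

  deg-relabel : ∀ {n} (σ : Permutation′ n) (G : Graph n) a → deg (relabel σ G) a ≡ deg G (σ ⟨$⟩ʳ a)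
  deg-relabel σ G a = begin
    deg (relabel σ G) a                         ≡⟨ deg≡∑ (relabel σ G) a ⟩
    ∑[ b < _ ] indicator (G (σ ⟨$⟩ʳ a) (σ ⟨$⟩ʳ b)) ≡⟨ sum-permute (indicator ∘ G (σ ⟨$⟩ʳ a)) σ ⟨
    ∑[ b < _ ] indicator (G (σ ⟨$⟩ʳ a) b)         ≡⟨ deg≡∑ G (σ ⟨$⟩ʳ a) ⟨
    deg G (σ ⟨$⟩ʳ a) ∎

  ∑deg-relabel : ∀ {n} (σ : Permutation′ n) (G : Graph n) →
    ∑[ a < n ] deg (relabel σ G) a ≡ ∑[ a < n ] deg G a
  ∑deg-relabel σ G = trans (sum-cong-≗ (deg-relabel σ G)) (sym (sum-permute (deg G) σ))

  ∑deg-addVertex : ∀ {n} (G : Graph n) {u v} → u ≢ v →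
    ∑[ a < suc n ] deg (addVertex G u v) a ≡ 4 + ∑[ a < n ] deg G a
  ∑deg-addVertex {n} G {u} {v} u≢v = begin
    deg G′ zero + ∑[ w < n ] deg G′ (suc w)
      ≡⟨ cong₂ _+_ (trans (deg≡∑ G′ zero) (∑-indicator-pair u≢v)) (sum-cong-≗ deg-old) ⟩
    2 + ∑[ w < n ] (new-edges w + deg G w)
      ≡⟨ cong (2 +_) (∑-distrib-+ new-edges (deg G)) ⟩
    2 + (∑[ w < n ] new-edges w + ∑[ w < n ] deg G w)
      ≡⟨ cong (λ k → 2 + (k + ∑[ w < n ] deg G w)) (∑-indicator-pair u≢v) ⟩
    4 + ∑[ w < n ] deg G w ∎
    where
    G′ : Graph (suc n)
    G′ = addVertex G u v
    new-edges : Fin n → ℕ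
    new-edges w = indicator (⌊ w Fin.≟ u ⌋ ∨ ⌊ w Fin.≟ v ⌋)
    deg-old : ∀ w → deg G′ (suc w) ≡ new-edges w + deg G w
    deg-old w = trans (deg≡∑ G′ (suc w)) (cong (_+_ (new-edges w)) (sym (deg≡∑ G w)))

  twoTree-irreflexive : ∀ {n} {G : Graph n} → TwoTree n G → ∀ a → G a a ≡ false
  twoTree-irreflexive triangle zero             = refl
  twoTree-irreflexive triangle (suc zero)       = refl
  twoTree-irreflexive triangle (suc (suc zero)) = refl
  twoTree-irreflexive (extend u v t _) zero     = refl
  twoTree-irreflexive (extend u v t _) (suc a)  = twoTree-irreflexive t a
  twoTree-irreflexive (rename σ t) a            = twoTree-irreflexive t (σ ⟨$⟩ʳ a)

  twoTree-edge⇒≢ : ∀ {n} {G : Graph n} → TwoTree n G → ∀ {u v} → G u v ≡ true → u ≢ v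
  twoTree-edge⇒≢ t {u} Guv≡true refl with trans (sym (twoTree-irreflexive t u)) Guv≡true
  ... | ()

  twoTree-∑deg : ∀ {n} {G : Graph n} → TwoTree n G → ∑[ a < n ] deg G a + 6 ≡ 4 * n
  twoTree-∑deg triangle = refl
  twoTree-∑deg {suc n} (extend {G = G} u v t Guv≡true) = begin
    ∑[ a < suc n ] deg (addVertex G u v) a + 6 ≡⟨ cong (_+ 6) (∑deg-addVertex G (twoTree-edge⇒≢ t Guv≡true)) ⟩
    4 + (∑[ a < n ] deg G a + 6)               ≡⟨ cong (4 +_) (twoTree-∑deg t) ⟩
    4 + 4 * n                                  ≡⟨ *-suc 4 n ⟨
    4 * suc n ∎
  twoTree-∑deg (rename {G = G} σ t) = trans (cong (_+ 6) (∑deg-relabel σ G)) (twoTree-∑deg t)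

  isCore : ℕ → ℕ → ℕ
  isCore Δ m = indicator (does (m ≟ Δ))

  isTail : ℕ → ℕ → ℕ → ℕ
  isTail Δ k m = indicator (does (¬? (m ≟ Δ)) ∧ does (m ≟ k))

  tailCount≡∑ : ∀ {n} (G : Graph n) Δ k → tailCount G Δ k ≡ ∑[ v < n ] isTail Δ k (deg G v)
  tailCount≡∑ {n} G Δ k =
    trans (cong length (filter-filter has-degree-k non-core (allV n)))
          (length-filter-tabulate (non-core ∩? has-degree-k) id)
    where
    has-degree-k : Decidable (λ v → deg G v ≡ k)
    has-degree-k v = deg G v ≟ k
    non-core : Decidable (λ v → deg G v ≢ Δ)
    non-core v = ¬? (deg G v ≟ Δ)

  tail23-indicators : ∀ {Δ m} → (m ≢ Δ → m ≡ 2 ⊎ m ≡ 3) →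
    (isCore Δ m + isTail Δ 2 m + isTail Δ 3 m ≡ 1) ×
    (isCore Δ m * Δ + isTail Δ 2 m * 2 + isTail Δ 3 m * 3 ≡ m)
  -- does (m ≟ k) computes to the builtin m ≡ᵇ k, which `with m ≟ Δ` does not abstract;
  -- hence the rewrites.
  tail23-indicators {Δ} {m} tail23 with m ≟ Δ
  ... | yes refl rewrite dec-true (m ≟ m) refl = refl , solve (m ∷ [])
  ... | no m≢Δ with tail23 m≢Δ
  ...   | inj₁ refl rewrite dec-false (2 ≟ Δ) m≢Δ = refl , refl
  ...   | inj₂ refl rewrite dec-false (3 ≟ Δ) m≢Δ = refl , refl

  module TailCounts {n} (d : Fin n → ℕ) {Δ} {a b : Fin n} (a≢b : a ≢ b) (da : d a ≡ Δ) (db : d b ≡ Δ)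
    (core-unique : ∀ v → d v ≡ Δ → v ≡ a ⊎ v ≡ b) (tail23 : ∀ v → d v ≢ Δ → d v ≡ 2 ⊎ d v ≡ 3) where

    ∑core≡2 : ∑[ v < n ] isCore Δ (d v) ≡ 2
    ∑core≡2 = trans (sum-cong-≗ core≡pair) (∑-indicator-pair a≢b)
      where
      core⇔pair : ∀ v → d v ≡ Δ ⇔ (v ≡ a ⊎ v ≡ b)
      core⇔pair v = mk⇔ (core-unique v) λ { (inj₁ refl) → da ; (inj₂ refl) → db }
      core≡pair : ∀ v → isCore Δ (d v) ≡ indicator (⌊ v Fin.≟ a ⌋ ∨ ⌊ v Fin.≟ b ⌋)
      core≡pair v = cong indicator (begin
        does (d v ≟ Δ)                        ≡⟨ does-⇔ (core⇔pair v) (d v ≟ Δ) (v Fin.≟ a ⊎-dec v Fin.≟ b) ⟩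
        does (v Fin.≟ a) ∨ does (v Fin.≟ b)   ≡⟨ cong₂ _∨_ (isYes≗does (v Fin.≟ a)) (isYes≗does (v Fin.≟ b)) ⟨
        ⌊ v Fin.≟ a ⌋ ∨ ⌊ v Fin.≟ b ⌋ ∎)

    vertexCount : n ≡ 2 + ∑[ v < n ] isTail Δ 2 (d v) + ∑[ v < n ] isTail Δ 3 (d v)
    vertexCount = begin
      n
        ≡⟨ ∑-one n ⟨
      ∑[ v < n ] 1
        ≡⟨ sum-cong-≗ (proj₁ ∘ tail23-indicators ∘ tail23) ⟨
      ∑[ v < n ] (isCore Δ (d v) + isTail Δ 2 (d v) + isTail Δ 3 (d v))
        ≡⟨ ∑-distrib-+₃ (isCore Δ ∘ d) (isTail Δ 2 ∘ d) (isTail Δ 3 ∘ d) ⟩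
      ∑[ v < n ] isCore Δ (d v) + ∑[ v < n ] isTail Δ 2 (d v) + ∑[ v < n ] isTail Δ 3 (d v)
        ≡⟨ cong (λ c → c + ∑[ v < n ] isTail Δ 2 (d v) + ∑[ v < n ] isTail Δ 3 (d v)) ∑core≡2 ⟩
      2 + ∑[ v < n ] isTail Δ 2 (d v) + ∑[ v < n ] isTail Δ 3 (d v) ∎

    degreeSum : sum d ≡ 2 * Δ + ∑[ v < n ] isTail Δ 2 (d v) * 2 + ∑[ v < n ] isTail Δ 3 (d v) * 3
    degreeSum = begin
      sum d
        ≡⟨ sum-cong-≗ (proj₂ ∘ tail23-indicators ∘ tail23) ⟨
      ∑[ v < n ] (isCore Δ (d v) * Δ + isTail Δ 2 (d v) * 2 + isTail Δ 3 (d v) * 3)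
        ≡⟨ ∑-distrib-+₃ (λ v → isCore Δ (d v) * Δ) (λ v → isTail Δ 2 (d v) * 2) (λ v → isTail Δ 3 (d v) * 3) ⟩
      ∑[ v < n ] (isCore Δ (d v) * Δ) + ∑[ v < n ] (isTail Δ 2 (d v) * 2) + ∑[ v < n ] (isTail Δ 3 (d v) * 3)
        ≡⟨ cong₂ _+_ (cong₂ _+_ (*-distribʳ-sum Δ (isCore Δ ∘ d)) (*-distribʳ-sum 2 (isTail Δ 2 ∘ d))) (*-distribʳ-sum 3 (isTail Δ 3 ∘ d)) ⟨
      ∑[ v < n ] isCore Δ (d v) * Δ + ∑[ v < n ] isTail Δ 2 (d v) * 2 + ∑[ v < n ] isTail Δ 3 (d v) * 3
        ≡⟨ cong (λ c → c * Δ + ∑[ v < n ] isTail Δ 2 (d v) * 2 + ∑[ v < n ] isTail Δ 3 (d v) * 3) ∑core≡2 ⟩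
      2 * Δ + ∑[ v < n ] isTail Δ 2 (d v) * 2 + ∑[ v < n ] isTail Δ 3 (d v) * 3 ∎

  tail-system : ∀ {n Δ x y s} → n ≡ 2 + y + x → s ≡ 2 * Δ + y * 2 + x * 3 → s + 6 ≡ 4 * n →
    (x + 2 * (1 + Δ) ≡ 2 * n) × (y + n ≡ 2 * Δ)
  tail-system {Δ = Δ} {x} {y} refl refl handshake = x-equation , y-equation
    where
    core-degree : x + 2 * (1 + y) ≡ 2 * Δ
    core-degree = +-cancelʳ-≡ (y * 2 + x * 3 + 6) _ _ (begin
      x + 2 * (1 + y) + (y * 2 + x * 3 + 6) ≡⟨ solve (x ∷ y ∷ []) ⟩
      4 * (2 + y + x)                       ≡⟨ handshake ⟨
      2 * Δ + y * 2 + x * 3 + 6             ≡⟨ solve (Δ ∷ x ∷ y ∷ []) ⟩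
      2 * Δ + (y * 2 + x * 3 + 6)           ∎)
    x-equation : x + 2 * (1 + Δ) ≡ 2 * (2 + y + x)
    x-equation = begin
      x + 2 * (1 + Δ)            ≡⟨ solve (x ∷ Δ ∷ []) ⟩
      x + 2 + 2 * Δ              ≡⟨ cong (x + 2 +_) core-degree ⟨
      x + 2 + (x + 2 * (1 + y))  ≡⟨ solve (x ∷ y ∷ []) ⟩
      2 * (2 + y + x)            ∎
    y-equation : y + (2 + y + x) ≡ 2 * Δ
    y-equation = begin
      y + (2 + y + x)  ≡⟨ solve (x ∷ y ∷ []) ⟩
      x + 2 * (1 + y)  ≡⟨ core-degree ⟩
      2 * Δ            ∎

open import Data.Integer using (+_; _-_; _*_)
open import Data.Integer using (ℤ; _+_; ∣_∣)
open import Data.Integer.Properties using (pos-+; pos-*; abs-*; +-0-abelianGroup)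
open import Algebra.Bundles using (AbelianGroup)
open import Algebra.Properties.Group (AbelianGroup.group +-0-abelianGroup) using (quasigroup)
open import Algebra.Properties.Quasigroup quasigroup using (x≈z//y)
import Data.Integer.Tactic.RingSolver as ℤ-Solver

m+n≡o⇒m≡o-n : ∀ {m n o} → m ℕ.+ n ≡ o → + m ≡ + o - + n
m+n≡o⇒m≡o-n {m} {n} eq = x≈z//y (+ m) (+ n) _ (trans (sym (pos-+ m n)) (cong +_ eq))

+m≡2*k⇒2∣m : ∀ {m} {k : ℤ} → + m ≡ + 2 * k → 2 ∣ m
+m≡2*k⇒2∣m {k = k} eq = subst (2 ∣_) (trans (sym (abs-* (+ 2) k)) (cong ∣_∣ (sym eq))) (m∣m*n ∣ k ∣)

tail-formulas : ∀ {n Δ x y s} → n ≡ 2 ℕ.+ y ℕ.+ x → s ≡ 2 ℕ.* Δ ℕ.+ y ℕ.* 2 ℕ.+ x ℕ.* 3 → s ℕ.+ 6 ≡ 4 ℕ.* n →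
  (+ x ≡ + 2 * (+ n - + 1 - + Δ)) × (+ y ≡ + 2 * + Δ - + n)
tail-formulas {n} {Δ} {x} {y} vertices degrees handshake = x-formula , y-formula
  where
  equations : (x ℕ.+ 2 ℕ.* (1 ℕ.+ Δ) ≡ 2 ℕ.* n) × (y ℕ.+ n ≡ 2 ℕ.* Δ)
  equations = tail-system vertices degrees handshake
  x-formula : + x ≡ + 2 * (+ n - + 1 - + Δ)
  x-formula = begin
    + x                               ≡⟨ m+n≡o⇒m≡o-n (proj₁ equations) ⟩
    + (2 ℕ.* n) - + (2 ℕ.* (1 ℕ.+ Δ)) ≡⟨ cong₂ _-_ (pos-* 2 n) (trans (pos-* 2 (1 ℕ.+ Δ)) (cong (+ 2 *_) (pos-+ 1 Δ))) ⟩
    + 2 * + n - + 2 * (+ 1 + + Δ)     ≡⟨ distribute (+ n) (+ Δ) ⟩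
    + 2 * (+ n - + 1 - + Δ)           ∎
    where
    distribute : ∀ i j → + 2 * i - + 2 * (+ 1 + j) ≡ + 2 * (i - + 1 - j)
    distribute = ℤ-Solver.solve-∀
  y-formula : + y ≡ + 2 * + Δ - + n
  y-formula = trans (m+n≡o⇒m≡o-n (proj₂ equations)) (cong (_- + n) (pos-* 2 Δ))

lemma4p1 : (n Δ : ℕ) (G : Graph n) → StrongBicentral G Δ → TailSet23 G Δ →
    (+ tailCount G Δ 3 ≡ + 2 * (+ n - + 1 - + Δ)) ×
    (+ tailCount G Δ 2 ≡ + 2 * + Δ - + n) ×
    (2 ∣ tailCount G Δ 3)
lemma4p1 n Δ G (twoTree , _ , _ , a , b , a≢b , da , db , _ , core-unique) tail23
  rewrite tailCount≡∑ G Δ 3 | tailCount≡∑ G Δ 2 =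
    let x-formula , y-formula = tail-formulas vertexCount degreeSum (twoTree-∑deg twoTree)
    in  x-formula , y-formula , +m≡2*k⇒2∣m x-formula
  where open TailCounts (deg G) a≢b da db core-unique tail23
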